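{- Let $n\geq 2$. Then $\operatorname{Aut}(\overline{M}_n)=\operatorname{Im}\beta^\ast_{n,n-1}\rtimes\operatorname{Sym}(\Omega)$, acting as described below. In particular, $\overline{M}_n$ and $M_n$ are interdefinable.
   Context: $\Omega$ is a countably infinite set; $[X]^m$ is the set of $m$-subsets of $X$; $\mathbb{F}_2^{[\Omega]^m}$ is the group of functions $[\Omega]^m\to\mathbb{F}_2$. $\beta^\ast_{n,n-1}:\mathbb{F}_2^{[\Omega]^{n-1}}\to\mathbb{F}_2^{[\Omega]^n}$, $(\beta^\ast_{n,n-1}f)(\omega)=\sum_{x\in[\omega]^{n-1}}f(x)$. Let $C=[\Omega]^n\times\mathbb{Z}/2\mathbb{Z}$, $E\subseteq\Omega\times[\Omega]^n$ the membership relation, $\pi:C\to[\Omega]^n$ the first projection, and $P\subseteq C^{n+1}$ the set of tuples $((w_1,\delta_1),\dots,(w_{n+1},\delta_{n+1}))$ such that there are distinct $c_1,\dots,c_{n+1}\in\Omega$ with $w_i=\{c_1,\dots,c_{n+1}\}\setminus\{c_i\}$ for all $i$ and $\delta_1+\dots+\delta_{n+1}=0$. $\overline{M}_n$ is the 3-sorted structure with sorts $\Omega$, $[\Omega]^n$, $C$ and relations $E$, $P$ and function $\pi$. The group $\operatorname{Im}\beta^\ast_{n,n-1}\rtimes\operatorname{Sym}(\Omega)$ acts on these sorts by: $g\sigma$ acts on $\Omega$ and $[\Omega]^n$ via $\sigma$, and on $C$ by $(w,x)\mapsto(w^\sigma,x+g(w))$. $M_n$ is the structure on the same sorts (with $C$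 identified with $[\Omega]^n\times\mathbb{F}_2$) whose automorphism group is $\operatorname{Im}\beta^\ast_{n,n-1}\rtimes\operatorname{Sym}(\Omega)$ with this action. Two structures on the same universe are interdefinable when they have the same automorphism group (as countable $\aleph_0$-categorical structures). -}

module Defs where

open import Data.Nat using (ℕ; zero; suc; _<_)
open import Data.Bool using (Bool; false; _xor_)
open import Data.Fin using (Fin; zero; suc)
open import Data.Vec using (Vec; []; _∷_; removeAt)
open import Data.Vec.Relation.Unary.All using (All; []; _∷_)
open import Data.Vec.Membership.Propositional using (_∈_)
open import Data.Product using (Σ; _×_; _,_; proj₁; proj₂; ∃)
open import Data.Unit using (⊤; tt)
open import Relation.Binary.PropositionalEquality using (_≡_)
open import Relation.Nullary using (¬_)
open import Function.Definitions using (Injective)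
open import Function.Bundles using (_⇔_; _↔_; Inverse)

-- Ω := ℕ (a countably infinite set).

-- Strictly increasing vectors: canonical representatives of finite sets.
Incr : ∀ {m} → Vec ℕ m → Set
Incr []       = ⊤
Incr (x ∷ xs) = All (x <_) xs × Incr xs

-- [Ω]^m : m-subsets of ℕ, represented as strictly increasing m-vectors.
Sub : ℕ → Set
Sub m = Σ (Vec ℕ m) Incr

_∈ₛ_ : ∀ {m} → ℕ → Sub m → Set
x ∈ₛ w = x ∈ proj₁ w

private
  all-removeAt : ∀ {m} {P : ℕ → Set} (v : Vec ℕ (suc m)) (i : Fin (suc m)) →
                 All P v → All P (removeAt v i)
  all-removeAt (x ∷ xs)         zero    (_ ∷ ps) = ps
  all-removeAt (x ∷ xs@(_ ∷ _)) (suc i) (p ∷ ps) = p ∷ all-removeAt xs i ps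

  incr-removeAt : ∀ {m} (v : Vec ℕ (suc m)) (i : Fin (suc m)) →
                  Incr v → Incr (removeAt v i)
  incr-removeAt (x ∷ xs)         zero    (_ , q) = q
  incr-removeAt (x ∷ xs@(_ ∷ _)) (suc i) (a , q) =
    all-removeAt xs i a , incr-removeAt xs i q

removeSub : ∀ {m} → Sub (suc m) → Fin (suc m) → Sub m
removeSub (v , p) i = removeAt v i , incr-removeAt v i p

sumF2 : ∀ {k} → (Fin k → Bool) → Bool
sumF2 {zero}  f = false
sumF2 {suc k} f = f zero xor sumF2 (λ i → f (suc i))

-- β*_{n,n-1} : 𝔽₂^{[Ω]^{n-1}} → 𝔽₂^{[Ω]^n},
-- (β* f)(ω) = Σ_{x ∈ [ω]^{n-1}} f(x); the (n-1)-subsets of ω are exactly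
-- the sets ω minus one of its n elements.  (n = 0 is never used.)
β* : (n : ℕ) → (Sub (Data.Nat.pred n) → Bool) → Sub n → Bool
β* zero    f ω = false
β* (suc m) f ω = sumF2 (λ i → f (removeSub ω i))

InImβ* : (n : ℕ) → (Sub n → Bool) → Set
InImβ* n g = Σ (Sub (Data.Nat.pred n) → Bool) λ f → ∀ ω → g ω ≡ β* n f ω

C : ℕ → Set
C n = Sub n × Bool

π : ∀ {n} → C n → Sub n
π = proj₁

E : ∀ {n} → ℕ → Sub n → Set
E c w = c ∈ₛ w

P : (n : ℕ) → (Fin (suc n) → C n) → Set
P n t = Σ (Fin (suc n) → ℕ) λ c →
          Injective _≡_ _≡_ c
        × (∀ i x → (x ∈ₛ proj₁ (t i)) ⇔ (Σ (Fin (suc n)) λ j → ¬ (j ≡ i) × c j ≡ x))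
        × sumF2 (λ i → proj₂ (t i)) ≡ false

record IsAutMbar (n : ℕ) (α : ℕ ↔ ℕ) (β : Sub n ↔ Sub n) (γ : C n ↔ C n) : Set where
  field
    pres-E : ∀ c w → E c w ⇔ E (Inverse.to α c) (Inverse.to β w)
    pres-π : ∀ z → π (Inverse.to γ z) ≡ Inverse.to β (π z)
    pres-P : ∀ (t : Fin (suc n) → C n) → P n t ⇔ P n (λ i → Inverse.to γ (t i))

-- The triple is the action of some gσ ∈ Im β*_{n,n-1} ⋊ Sym(Ω):
-- on Ω via σ (= α), on [Ω]^n via w ↦ w^σ, and on C via (w,x) ↦ (w^σ, x + g(w)).
record IsActionOf (n : ℕ) (α : ℕ ↔ ℕ) (β : Sub n ↔ Sub n) (γ : C n ↔ C n) : Set where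
  field
    g      : Sub n → Bool
    g∈Im   : InImβ* n g
    β-is-σ : ∀ w x → (x ∈ₛ Inverse.to β w) ⇔ (Σ ℕ λ c → c ∈ₛ w × Inverse.to α c ≡ x)
    γ-is-gσ : ∀ w δ → Inverse.to γ (w , δ) ≡ (Inverse.to β w , δ xor g w)

-- An automorphism acts on the reduct (Ω, [Ω]ⁿ, E) as some σ ∈ Sym(Ω), and since it commutes
-- with π it acts on each fibre π⁻¹(w) ≅ 𝔽₂ by a translation δ ↦ δ + g(w).  Applying P to the
-- facets of an (n+1)-set, all labelled 0, shows that g is a cocycle: it sums to 0 over the facets
-- of every (n+1)-set.  Coning off from the point 0 writes such a g as β* f, with f(x) = g({0} ∪ x)
-- for 0 ∉ x and f(x) = 0 otherwise.  Conversely, for g = β* f the sum of g over the facets of an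
-- (n+1)-set counts every (n-1)-subset twice, so translating by g preserves the parity in P.
module Submission where

open import Algebra.Bundles using (CommutativeRing)
open import Data.Bool using (Bool; true; false; _xor_)
open import Data.Bool.Properties
  using (xor-same; xor-identityʳ; ¬-not; xor-∧-commutativeRing)
open import Data.Empty using (⊥-elim)
open import Data.Fin using (Fin; zero; suc; punchIn; punchOut)
open import Data.Fin.Properties
  using (suc-injective; punchInᵢ≢i; punchIn-punchOut; punchOut-punchIn; punchOut-injective)
open import Data.Nat using (ℕ; zero; suc; _≤_; _<_; s≤s; z≤n; z<s; _<?_)
open import Data.Nat.Properties using (<-irrelevant; <-trans; <-irrefl; <-asym; ≮⇒≥; ≤∧≢⇒<)
open import Data.Product using (Σ; ∃; _×_; _,_; proj₁; proj₂)
open import Data.Sum using (_⊎_; inj₁; inj₂)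
open import Data.Unit using (tt)
open import Data.Vec using (Vec; []; _∷_; removeAt; lookup)
open import Data.Vec.Properties using (removeAt-punchOut)
open import Data.Vec.Membership.Propositional using (_∈_; _∉_)
open import Data.Vec.Membership.Propositional.Properties using (∈-lookup)
open import Data.Vec.Relation.Unary.All as All using (All; []; _∷_; all?)
open import Data.Vec.Relation.Unary.Any as Any using (here; there)
open import Data.Vec.Relation.Unary.Any.Properties using (lookup-index)
open import Function using (_∘_)
open import Function.Bundles using (_⇔_; _↔_; Inverse; Equivalence; Injection; mk⇔)
open import Function.Construct.Composition using (_⇔-∘_)
open import Function.Construct.Symmetry using (⇔-sym; ↔-sym)
open import Function.Definitions using (Injective)
open import Function.Properties.Inverse using (↔⇒↣)
open import Relation.Binary.PropositionalEquality
open import Relation.Nullary using (¬_; Dec; yes; no)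
open import Relation.Nullary.Decidable using (_×-dec_)

open import Defs

open import Algebra.Properties.CommutativeMonoid.Sum
  (CommutativeRing.+-commutativeMonoid xor-∧-commutativeRing)
  using (sum; sum-remove; ∑-distrib-+; sum-replicate-zero)

open Equivalence using (to; from)

xor≡false⇒≡ : ∀ a b → a xor b ≡ false → a ≡ b
xor≡false⇒≡ false false _ = refl
xor≡false⇒≡ true  true  _ = refl

↔-injective : {A B : Set} (α : A ↔ B) → Injective _≡_ _≡_ (Inverse.to α)
↔-injective α = Injection.injective (↔⇒↣ α)

-- Sums in 𝔽₂

sumF2≡sum : ∀ {k} (f : Fin k → Bool) → sumF2 f ≡ sum f
sumF2≡sum {zero}  f = refl
sumF2≡sum {suc k} f = cong (f zero xor_) (sumF2≡sum (f ∘ suc))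

sumF2-cong : ∀ {k} {f g : Fin k → Bool} → f ≗ g → sumF2 f ≡ sumF2 g
sumF2-cong {zero}  f≗g = refl
sumF2-cong {suc k} f≗g = cong₂ _xor_ (f≗g zero) (sumF2-cong (f≗g ∘ suc))

sumF2-false : ∀ k → sumF2 {k} (λ _ → false) ≡ false
sumF2-false k = trans (sumF2≡sum {k} (λ _ → false)) (sum-replicate-zero k)

sumF2-xor : ∀ {k} (f g : Fin k → Bool) →
            sumF2 (λ i → f i xor g i) ≡ sumF2 f xor sumF2 g
sumF2-xor f g = begin
  sumF2 (λ i → f i xor g i) ≡⟨ sumF2≡sum (λ i → f i xor g i) ⟩
  sum (λ i → f i xor g i)   ≡⟨ ∑-distrib-+ f g ⟩
  sum f xor sum g           ≡⟨ cong₂ _xor_ (sumF2≡sum f) (sumF2≡sum g) ⟨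
  sumF2 f xor sumF2 g       ∎
  where open ≡-Reasoning

sumF2-remove : ∀ {k} (f : Fin (suc k) → Bool) (i : Fin (suc k)) →
               sumF2 f ≡ f i xor sumF2 (f ∘ punchIn i)
sumF2-remove f i = begin
  sumF2 f                          ≡⟨ sumF2≡sum f ⟩
  sum f                            ≡⟨ sum-remove {i = i} f ⟩
  f i xor sum (f ∘ punchIn i)      ≡⟨ cong (f i xor_) (sumF2≡sum (f ∘ punchIn i)) ⟨
  f i xor sumF2 (f ∘ punchIn i)    ∎
  where open ≡-Reasoning

sumF2-reindex : ∀ {k} (f : Fin k → Bool) {p : Fin k → Fin k} →
                Injective _≡_ _≡_ p → sumF2 (f ∘ p) ≡ sumF2 f
sumF2-reindex {zero}  f p-inj = refl
sumF2-reindex {suc k} f {p} p-inj = begin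
  f (p zero) xor sumF2 (f ∘ p ∘ suc)         ≡⟨ cong (f (p zero) xor_) remaining ⟩
  f (p zero) xor sumF2 (f ∘ punchIn (p zero)) ≡⟨ sumF2-remove f (p zero) ⟨
  sumF2 f                                    ∎
  where
  open ≡-Reasoning
  p₀≢ : ∀ j → p zero ≢ p (suc j)
  p₀≢ j = (λ ()) ∘ p-inj
  q : Fin k → Fin k
  q j = punchOut (p₀≢ j)
  q-inj : Injective _≡_ _≡_ q
  q-inj {a} {b} = suc-injective ∘ p-inj ∘ punchOut-injective (p₀≢ a) (p₀≢ b)
  remaining : sumF2 (f ∘ p ∘ suc) ≡ sumF2 (f ∘ punchIn (p zero))
  remaining = trans (sumF2-cong (λ j → cong f (sym (punchIn-punchOut (p₀≢ j)))))
               (sumF2-reindex (f ∘ punchIn (p zero)) q-inj)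

-- Strictly increasing vectors

Incr-irrelevant : ∀ {m} (v : Vec ℕ m) (p q : Incr v) → p ≡ q
Incr-irrelevant []      tt      tt      = refl
Incr-irrelevant (x ∷ v) (a , p) (b , q) =
  cong₂ _,_ (All.irrelevant <-irrelevant a b) (Incr-irrelevant v p q)

Sub-≡ : ∀ {m} {s t : Sub m} → proj₁ s ≡ proj₁ t → s ≡ t
Sub-≡ {s = v , p} {t = .v , q} refl = cong (v ,_) (Incr-irrelevant v p q)

Incr? : ∀ {m} (v : Vec ℕ m) → Dec (Incr v)
Incr? []      = yes tt
Incr? (x ∷ v) = all? (x <?_) v ×-dec Incr? v

lookup-injective : ∀ {m} {v : Vec ℕ m} → Incr v → Injective _≡_ _≡_ (lookup v)
lookup-injective {v = x ∷ v} (x<v , v↑) {zero}  {zero}  _ = refl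
lookup-injective {v = x ∷ v} (x<v , v↑) {zero}  {suc j} e =
  ⊥-elim (<-irrefl e (All.lookup x<v (∈-lookup j v)))
lookup-injective {v = x ∷ v} (x<v , v↑) {suc i} {zero}  e =
  ⊥-elim (<-irrefl (sym e) (All.lookup x<v (∈-lookup i v)))
lookup-injective {v = x ∷ v} (x<v , v↑) {suc i} {suc j} e =
  cong suc (lookup-injective v↑ e)

Incr-ext : ∀ {m} {s t : Vec ℕ m} → Incr s → Incr t →
           (∀ {x} → x ∈ s → x ∈ t) → (∀ {x} → x ∈ t → x ∈ s) → s ≡ t
Incr-ext {s = []}    {[]}    _         _         _   _   = refl
Incr-ext {s = x ∷ s} {y ∷ t} (x<s , s↑) (y<t , t↑) s⊆t t⊆s =
  cong₂ _∷_ x≡y (Incr-ext s↑ t↑ s⊆t′ t⊆s′)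
  where
  x≡y : x ≡ y
  x≡y with s⊆t (here refl) | t⊆s (here refl)
  ... | here x≡y   | _          = x≡y
  ... | there _    | here y≡x   = sym y≡x
  ... | there x∈t  | there y∈s  = ⊥-elim (<-asym (All.lookup y<t x∈t) (All.lookup x<s y∈s))
  s⊆t′ : ∀ {z} → z ∈ s → z ∈ t
  s⊆t′ {z} z∈s with s⊆t (there z∈s)
  ... | here z≡y  = ⊥-elim (<-irrefl (trans x≡y (sym z≡y)) (All.lookup x<s z∈s))
  ... | there z∈t = z∈t
  t⊆s′ : ∀ {z} → z ∈ t → z ∈ s
  t⊆s′ {z} z∈t with t⊆s (there z∈t)
  ... | here z≡x  = ⊥-elim (<-irrefl (trans (sym x≡y) (sym z≡x)) (All.lookup y<t z∈t))
  ... | there z∈s = z∈s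

Sub-ext : ∀ {m} {s t : Sub m} → (∀ x → x ∈ₛ s ⇔ x ∈ₛ t) → s ≡ t
Sub-ext {s = s} {t} s≈t =
  Sub-≡ (Incr-ext (proj₂ s) (proj₂ t) (to (s≈t _)) (from (s≈t _)))

lookup-removeAt : ∀ {A : Set} {m} (v : Vec A (suc m)) i (k : Fin m) →
                  lookup (removeAt v i) k ≡ lookup v (punchIn i k)
lookup-removeAt v i k =
  trans (cong (lookup (removeAt v i)) (sym (punchOut-punchIn i)))
        (removeAt-punchOut v (punchInᵢ≢i i k ∘ sym))

∈-removeAt⁻ : ∀ {A : Set} {m} (v : Vec A (suc m)) i {x} → x ∈ removeAt v i →
              Σ (Fin (suc m)) λ j → j ≢ i × lookup v j ≡ x
∈-removeAt⁻ v i x∈ =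
  punchIn i k , punchInᵢ≢i i k , sym (trans (lookup-index x∈) (lookup-removeAt v i k))
  where k = Any.index x∈

∈-removeAt⁺ : ∀ {A : Set} {m} (v : Vec A (suc m)) {i j} → j ≢ i → lookup v j ∈ removeAt v i
∈-removeAt⁺ v {i} j≢i =
  subst (_∈ removeAt v i) (removeAt-punchOut v (j≢i ∘ sym)) (∈-lookup _ (removeAt v i))

removeAt-∷-suc : ∀ {A : Set} {m} x (v : Vec A (suc m)) i →
                 removeAt (x ∷ v) (suc i) ≡ x ∷ removeAt v i
removeAt-∷-suc x (_ ∷ _) i = refl

insert : ∀ {m} → ℕ → Vec ℕ m → Vec ℕ (suc m)
insert y []      = y ∷ []
insert y (x ∷ v) with y <? x
... | yes _ = y ∷ x ∷ v
... | no  _ = x ∷ insert y v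

∈-insert⁺ˡ : ∀ {m} y (v : Vec ℕ m) → y ∈ insert y v
∈-insert⁺ˡ y []      = here refl
∈-insert⁺ˡ y (x ∷ v) with y <? x
... | yes _ = here refl
... | no  _ = there (∈-insert⁺ˡ y v)

∈-insert⁺ʳ : ∀ {m} y {v : Vec ℕ m} {z} → z ∈ v → z ∈ insert y v
∈-insert⁺ʳ y {x ∷ v} z∈ with y <? x | z∈
... | yes _ | _          = there z∈
... | no  _ | here z≡x   = here z≡x
... | no  _ | there z∈v  = there (∈-insert⁺ʳ y z∈v)

∈-insert⁻ : ∀ {m} y (v : Vec ℕ m) {z} → z ∈ insert y v → z ≡ y ⊎ z ∈ v
∈-insert⁻ y []      (here z≡y) = inj₁ z≡y
∈-insert⁻ y (x ∷ v) z∈ with y <? x | z∈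
... | yes _ | here z≡y  = inj₁ z≡y
... | yes _ | there z∈v = inj₂ z∈v
... | no  _ | here z≡x  = inj₂ (here z≡x)
... | no  _ | there z∈  with ∈-insert⁻ y v z∈
...   | inj₁ z≡y  = inj₁ z≡y
...   | inj₂ z∈v  = inj₂ (there z∈v)

insert-All : ∀ {m} {P : ℕ → Set} {y} (v : Vec ℕ m) → P y → All P v → All P (insert y v)
insert-All     []      py []         = py ∷ []
insert-All {y = y} (x ∷ v) py (px ∷ pv) with y <? x
... | yes _ = py ∷ px ∷ pv
... | no  _ = px ∷ insert-All v py pv

insert-Incr : ∀ {m} {y} {v : Vec ℕ m} → y ∉ v → Incr v → Incr (insert y v)
insert-Incr {v = []}    _  _          = [] , tt
insert-Incr {y = y} {x ∷ v} y∉ (x<v , v↑) with y <? x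
... | yes y<x = (y<x ∷ All.map (<-trans y<x) x<v) , x<v , v↑
... | no  y≮x = insert-All v x<y x<v , insert-Incr (y∉ ∘ there) v↑
  where
  x<y : x < y
  x<y = ≤∧≢⇒< (≮⇒≥ y≮x) (λ x≡y → y∉ (here (sym x≡y)))

-- The complex β*

liftToVec : ∀ {m} → (Sub m → Bool) → Vec ℕ m → Bool
liftToVec f v with Incr? v
... | yes v↑ = f (v , v↑)
... | no  _  = false

liftToVec-Sub : ∀ {m} (f : Sub m → Bool) (s : Sub m) → liftToVec f (proj₁ s) ≡ f s
liftToVec-Sub f (v , v↑) with Incr? v
... | yes v↑′ = cong f (Sub-≡ refl)
... | no  ¬v↑ = ⊥-elim (¬v↑ v↑)

liftToVec-¬Incr : ∀ {m} (f : Sub m → Bool) {v} → ¬ Incr v → liftToVec f v ≡ false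
liftToVec-¬Incr f {v} ¬v↑ with Incr? v
... | yes v↑ = ⊥-elim (¬v↑ v↑)
... | no  _  = refl

sumF2-removeAt² : ∀ {A : Set} m (h : Vec A m → Bool) (v : Vec A (suc (suc m))) →
                  sumF2 (λ i → sumF2 (λ k → h (removeAt (removeAt v i) k))) ≡ false
sumF2-removeAt² zero    h (x ∷ y ∷ []) with h []
... | false = refl
... | true  = refl
-- Removing x first contributes S, removing it second contributes S again, and the remaining
-- terms are the same double sum for h (x ∷_).
sumF2-removeAt² (suc m) h (x ∷ y ∷ u) = begin
  S xor sumF2 (λ i → sumF2 (λ k → h (removeAt (x ∷ removeAt (y ∷ u) i) k)))
    ≡⟨ cong (S xor_) (sumF2-cong λ i → cong (h (removeAt (y ∷ u) i) xor_)
                       (sumF2-cong λ k → cong h (removeAt-∷-suc x (removeAt (y ∷ u) i) k))) ⟩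
  S xor sumF2 (λ i → h (removeAt (y ∷ u) i) xor
                     sumF2 (λ k → h (x ∷ removeAt (removeAt (y ∷ u) i) k)))
    ≡⟨ cong (S xor_) (sumF2-xor (h ∘ removeAt (y ∷ u)) T) ⟩
  S xor (S xor sumF2 T)
    ≡⟨ cong (λ b → S xor (S xor b)) (sumF2-removeAt² m (h ∘ (x ∷_)) (y ∷ u)) ⟩
  S xor (S xor false)
    ≡⟨ cong (S xor_) (xor-identityʳ S) ⟩
  S xor S
    ≡⟨ xor-same S ⟩
  false ∎
  where
  open ≡-Reasoning
  S : Bool
  S = sumF2 (λ k → h (removeAt (y ∷ u) k))
  T : Fin (suc (suc m)) → Bool
  T i = sumF2 (λ k → h (x ∷ removeAt (removeAt (y ∷ u) i) k))

β*∘β*≡0 : ∀ m (f : Sub m → Bool) (s : Sub (suc (suc m))) →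
          β* (suc (suc m)) (β* (suc m) f) s ≡ false
β*∘β*≡0 m f s =
  trans (sumF2-cong λ i → sumF2-cong λ k → sym (liftToVec-Sub f (removeSub (removeSub s i) k)))
        (sumF2-removeAt² m (liftToVec f) (proj₁ s))

-- The cone with apex 0: g ({0} ∪ x) when 0 ∉ x, and 0 otherwise (0 ∷ x is then not increasing).
cone : ∀ {k} → (Sub (suc k) → Bool) → Sub k → Bool
cone g x = liftToVec g (0 ∷ proj₁ x)

¬Incr-repeat : ∀ {k} x (v : Vec ℕ k) i → ¬ Incr (x ∷ removeAt (x ∷ v) (suc i))
¬Incr-repeat x (y ∷ v) i ((x<x ∷ _) , _) = <-irrefl refl x<x

cocycle⇒coboundary : ∀ k (g : Sub (suc k) → Bool) →
                     (∀ s → β* (suc (suc k)) g s ≡ false) → InImβ* (suc k) g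
cocycle⇒coboundary k g cocycle = cone g , g≡∂cone
  where
  open ≡-Reasoning
  g≡∂cone : ∀ ω → g ω ≡ β* (suc k) (cone g) ω
  g≡∂cone ω@(zero ∷ v , 0<v , v↑) = sym (begin
    liftToVec g (0 ∷ v) xor sumF2 (λ i → liftToVec g (0 ∷ removeAt (0 ∷ v) (suc i)))
      ≡⟨ cong₂ _xor_ (liftToVec-Sub g ω)
           (trans (sumF2-cong λ i → liftToVec-¬Incr g (¬Incr-repeat 0 v i)) (sumF2-false k)) ⟩
    g ω xor false
      ≡⟨ xor-identityʳ (g ω) ⟩
    g ω ∎)
  g≡∂cone ω@(suc a ∷ v , a<v , v↑) =
    xor≡false⇒≡ (g ω) _
      (trans (cong (g ω xor_) (sumF2-cong λ i → liftToVec-Sub g (removeSub 0∷ω (suc i))))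
             (cocycle 0∷ω))
    where
    0∷ω : Sub (suc (suc k))
    0∷ω = 0 ∷ suc a ∷ v , (z<s ∷ All.map (<-trans z<s) a<v) , a<v , v↑

-- Facets of an (n+1)-set

FacesOf : ∀ {n} → (Fin (suc n) → ℕ) → (Fin (suc n) → Sub n) → Set
FacesOf {n} c w = ∀ i x → (x ∈ₛ w i) ⇔ (Σ (Fin (suc n)) λ j → ¬ (j ≡ i) × c j ≡ x)

facesOf-resp : ∀ {n} {c} {w w′ : Fin (suc n) → Sub n} →
               (∀ i → w i ≡ w′ i) → FacesOf c w → FacesOf c w′
facesOf-resp w≡w′ faces i = subst (λ u → ∀ x → (x ∈ₛ u) ⇔ _) (w≡w′ i) (faces i)

removeSub-facesOf : ∀ {n} (s : Sub (suc n)) → FacesOf (lookup (proj₁ s)) (removeSub s)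
removeSub-facesOf (v , _) i x =
  mk⇔ (∈-removeAt⁻ v i) (λ { (j , j≢i , refl) → ∈-removeAt⁺ v j≢i })

-- The (n+1)-set is w 0 with the missing point c 0 inserted.
facesOf⇒removeSub : ∀ {n} {c : Fin (suc n) → ℕ} {w : Fin (suc n) → Sub n} →
  Injective _≡_ _≡_ c → FacesOf c w →
  Σ (Sub (suc n)) λ s → Σ (Fin (suc n) → Fin (suc n)) λ p →
    Injective _≡_ _≡_ p × (∀ i → w i ≡ removeSub s (p i))
facesOf⇒removeSub {n} {c} {w} c-inj faces = s , p , p-inj , w≡removeSub
  where
  c₀∉w₀ : c zero ∉ proj₁ (w zero)
  c₀∉w₀ c₀∈ with to (faces zero (c zero)) c₀∈
  ... | j , j≢0 , cj≡c₀ = j≢0 (c-inj cj≡c₀)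
  v : Vec ℕ (suc n)
  v = insert (c zero) (proj₁ (w zero))
  s : Sub (suc n)
  s = v , insert-Incr c₀∉w₀ (proj₂ (w zero))
  ∈v⇔ : ∀ x → x ∈ v ⇔ ∃ λ j → c j ≡ x
  ∈v⇔ x = mk⇔ points complete
    where
    points : x ∈ v → ∃ λ j → c j ≡ x
    points x∈ with ∈-insert⁻ (c zero) (proj₁ (w zero)) x∈
    ... | inj₁ x≡c₀ = zero , sym x≡c₀
    ... | inj₂ x∈w₀ with to (faces zero x) x∈w₀
    ...   | j , _ , cj≡x = j , cj≡x
    complete : (∃ λ j → c j ≡ x) → x ∈ v
    complete (zero  , refl) = ∈-insert⁺ˡ (c zero) (proj₁ (w zero))
    complete (suc j , cj≡x) =
      ∈-insert⁺ʳ (c zero) (from (faces zero x) (suc j , (λ ()) , cj≡x))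
  p : Fin (suc n) → Fin (suc n)
  p i = Any.index (from (∈v⇔ (c i)) (i , refl))
  c≡v∘p : ∀ i → c i ≡ lookup v (p i)
  c≡v∘p i = lookup-index (from (∈v⇔ (c i)) (i , refl))
  p-inj : Injective _≡_ _≡_ p
  p-inj {i} {j} pi≡pj =
    c-inj (trans (c≡v∘p i) (trans (cong (lookup v) pi≡pj) (sym (c≡v∘p j))))
  reindex : ∀ i x → (Σ (Fin (suc n)) λ j → ¬ (j ≡ i) × c j ≡ x)
                  ⇔ (Σ (Fin (suc n)) λ k → ¬ (k ≡ p i) × lookup v k ≡ x)
  reindex i x = mk⇔
    (λ { (j , j≢i , refl) → p j , j≢i ∘ p-inj , sym (c≡v∘p j) })
    (λ { (k , k≢pi , refl) → let (j , cj≡) = to (∈v⇔ _) (∈-lookup k v) in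
         j , (λ { refl → k≢pi (lookup-injective (proj₂ s) (trans (sym cj≡) (c≡v∘p j))) }) , cj≡ })
  w≡removeSub : ∀ i → w i ≡ removeSub s (p i)
  w≡removeSub i =
    Sub-ext λ x → ⇔-sym (removeSub-facesOf s (p i) x) ⇔-∘ (reindex i x ⇔-∘ faces i x)

coboundary-vanishes-on-facets :
  ∀ {m} (f : Sub m → Bool) (w : Fin (suc (suc m)) → Sub (suc m)) {c} →
  Injective _≡_ _≡_ c → FacesOf c w → sumF2 (β* (suc m) f ∘ w) ≡ false
coboundary-vanishes-on-facets {m} f w c-inj faces
  with s , p , p-inj , w≡removeSub ← facesOf⇒removeSub {w = w} c-inj faces = begin
    sumF2 (β* (suc m) f ∘ w)                 ≡⟨ sumF2-cong (cong (β* (suc m) f) ∘ w≡removeSub) ⟩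
    sumF2 (β* (suc m) f ∘ removeSub s ∘ p)   ≡⟨ sumF2-reindex (β* (suc m) f ∘ removeSub s) p-inj ⟩
    sumF2 (β* (suc m) f ∘ removeSub s)       ≡⟨ β*∘β*≡0 m f s ⟩
    false                                    ∎
  where open ≡-Reasoning

-- Automorphisms of M̄ₙ

IsImageOf : ∀ {n} → (ℕ ↔ ℕ) → (Sub n → Sub n) → Set
IsImageOf {n} α β = ∀ w x → (x ∈ₛ β w) ⇔ (Σ ℕ λ c → c ∈ₛ w × Inverse.to α c ≡ x)

preservesE⇔isImageOf : ∀ {n} (α : ℕ ↔ ℕ) (β : Sub n → Sub n) →
  (∀ c w → E c w ⇔ E (Inverse.to α c) (β w)) ⇔ IsImageOf α β
preservesE⇔isImageOf α β = mk⇔ image preserve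
  where
  open Inverse α using (strictlyInverseˡ) renaming (to to σ; from to σ⁻¹)
  image : (∀ c w → E c w ⇔ E (σ c) (β w)) → IsImageOf α β
  image pres w x = mk⇔
    (λ x∈ → σ⁻¹ x , from (pres (σ⁻¹ x) w) (subst (_∈ₛ β w) (sym (strictlyInverseˡ x)) x∈)
                  , strictlyInverseˡ x)
    (λ { (c , c∈ , refl) → to (pres c w) c∈ })
  preserve : IsImageOf α β → ∀ c w → E c w ⇔ E (σ c) (β w)
  preserve im c w = mk⇔
    (λ c∈ → from (im w (σ c)) (c , c∈ , refl))
    (λ σc∈ → let (c′ , c′∈ , σc′≡σc) = to (im w (σ c)) σc∈ in
             subst (_∈ₛ w) (↔-injective α σc′≡σc) c′∈)

module _ {n} (α : ℕ ↔ ℕ) (β : Sub n → Sub n) (β-is-σ : IsImageOf α β) where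
  open Inverse α using (strictlyInverseˡ; strictlyInverseʳ) renaming (to to σ; from to σ⁻¹)

  facesOf-image : ∀ {c w} → FacesOf c w → FacesOf (σ ∘ c) (β ∘ w)
  facesOf-image {c} {w} faces i y = mk⇔
    (λ y∈ → let (x , x∈ , σx≡y) = to (β-is-σ (w i) y) y∈
                (j , j≢i , cj≡x) = to (faces i x) x∈ in
            j , j≢i , trans (cong σ cj≡x) σx≡y)
    (λ { (j , j≢i , σcj≡y) →
           from (β-is-σ (w i) y) (c j , from (faces i (c j)) (j , j≢i , refl) , σcj≡y) })

  facesOf-preimage : ∀ {c′ w} → FacesOf c′ (β ∘ w) → FacesOf (σ⁻¹ ∘ c′) w
  facesOf-preimage {c′} {w} faces′ i x = mk⇔
    (λ x∈ → let (j , j≢i , c′j≡σx) = to (faces′ i (σ x)) (to (pres-E x (w i)) x∈) in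
            j , j≢i , trans (cong σ⁻¹ c′j≡σx) (strictlyInverseʳ x))
    (λ { (j , j≢i , refl) → from (pres-E (σ⁻¹ (c′ j)) (w i))
           (subst (_∈ₛ β (w i)) (sym (strictlyInverseˡ (c′ j)))
                  (from (faces′ i (c′ j)) (j , j≢i , refl))) })
    where
    pres-E : ∀ c w → E c w ⇔ E (σ c) (β w)
    pres-E = from (preservesE⇔isImageOf α β) β-is-σ

fibre-translation : ∀ {A : Set} (γ : (A × Bool) ↔ (A × Bool)) (b : A → A) →
  (∀ z → proj₁ (Inverse.to γ z) ≡ b (proj₁ z)) →
  ∀ a δ → Inverse.to γ (a , δ) ≡ (b a , δ xor proj₂ (Inverse.to γ (a , false)))
fibre-translation γ b over a false = cong₂ _,_ (over (a , false)) refl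
fibre-translation γ b over a true  = cong₂ _,_ (over (a , true)) (¬-not flipped)
  where
  flipped : proj₂ (Inverse.to γ (a , true)) ≢ proj₂ (Inverse.to γ (a , false))
  flipped e with ↔-injective γ (cong₂ _,_ (trans (over (a , true)) (sym (over (a , false)))) e)
  ... | ()

removeSub-P : ∀ {n} (s : Sub (suc n)) → P n (λ i → removeSub s i , false)
removeSub-P {n} s =
  lookup (proj₁ s) , lookup-injective (proj₂ s) , removeSub-facesOf s , sumF2-false (suc n)

automorphism⇒action : ∀ {k α β γ} → IsAutMbar (suc k) α β γ → IsActionOf (suc k) α β γ
automorphism⇒action {k} {α} {β} {γ} aut = record
  { g       = g
  ; g∈Im    = cocycle⇒coboundary k g cocycle
  ; β-is-σ  = to (preservesE⇔isImageOf α (Inverse.to β)) pres-E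
  ; γ-is-gσ = fibre-translation γ (Inverse.to β) pres-π
  }
  where
  open IsAutMbar aut
  g : Sub (suc k) → Bool
  g w = proj₂ (Inverse.to γ (w , false))
  cocycle : ∀ s → β* (suc (suc k)) g s ≡ false
  cocycle s with _ , _ , _ , parity ← to (pres-P (λ i → removeSub s i , false)) (removeSub-P s) =
    parity

action⇒automorphism : ∀ {k α β γ} → IsActionOf (suc k) α β γ → IsAutMbar (suc k) α β γ
action⇒automorphism {k} {α} {β} {γ} act = record
  { pres-E = from (preservesE⇔isImageOf α (Inverse.to β)) β-is-σ
  ; pres-π = λ (w , δ) → cong proj₁ (γ-is-gσ w δ)
  ; pres-P = λ t → mk⇔ (preserve t) (reflect t)
  }
  where
  open IsActionOf act
  open Inverse α using () renaming (to to σ; from to σ⁻¹)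
  γt : (Fin (suc (suc k)) → C (suc k)) → Fin (suc (suc k)) → C (suc k)
  γt t i = Inverse.to γ (t i)
  β∘π≗π∘γ : ∀ t i → Inverse.to β (proj₁ (t i)) ≡ proj₁ (γt t i)
  β∘π≗π∘γ t i = sym (cong proj₁ (γ-is-gσ (proj₁ (t i)) (proj₂ (t i))))
  parity-preserved : ∀ t {c} → Injective _≡_ _≡_ c → FacesOf c (proj₁ ∘ t) →
                     sumF2 (proj₂ ∘ γt t) ≡ sumF2 (proj₂ ∘ t)
  parity-preserved t c-inj faces = begin
    sumF2 (proj₂ ∘ γt t)
      ≡⟨ sumF2-cong (λ i → cong proj₂ (γ-is-gσ (proj₁ (t i)) (proj₂ (t i)))) ⟩
    sumF2 (λ i → proj₂ (t i) xor g (proj₁ (t i)))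
      ≡⟨ sumF2-xor (proj₂ ∘ t) (g ∘ proj₁ ∘ t) ⟩
    sumF2 (proj₂ ∘ t) xor sumF2 (g ∘ proj₁ ∘ t)
      ≡⟨ cong (sumF2 (proj₂ ∘ t) xor_) g-vanishes ⟩
    sumF2 (proj₂ ∘ t) xor false
      ≡⟨ xor-identityʳ _ ⟩
    sumF2 (proj₂ ∘ t) ∎
    where
    open ≡-Reasoning
    g-vanishes : sumF2 (g ∘ proj₁ ∘ t) ≡ false
    g-vanishes = trans (sumF2-cong (proj₂ g∈Im ∘ proj₁ ∘ t))
                       (coboundary-vanishes-on-facets (proj₁ g∈Im) (proj₁ ∘ t) c-inj faces)
  preserve : ∀ t → P (suc k) t → P (suc k) (γt t)
  preserve t (c , c-inj , faces , parity) =
      σ ∘ c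
    , c-inj ∘ ↔-injective α
    , facesOf-resp (β∘π≗π∘γ t) (facesOf-image α (Inverse.to β) β-is-σ faces)
    , trans (parity-preserved t c-inj faces) parity
  reflect : ∀ t → P (suc k) (γt t) → P (suc k) t
  reflect t (c′ , c′-inj , faces′ , parity′) =
      σ⁻¹ ∘ c′
    , c-inj
    , faces
    , trans (sym (parity-preserved t c-inj faces)) parity′
    where
    c-inj : Injective _≡_ _≡_ (σ⁻¹ ∘ c′)
    c-inj = c′-inj ∘ ↔-injective (↔-sym α)
    faces : FacesOf (σ⁻¹ ∘ c′) (proj₁ ∘ t)
    faces = facesOf-preimage α (Inverse.to β) β-is-σ (facesOf-resp (sym ∘ β∘π≗π∘γ t) faces′)

proposition6p2 : (n : ℕ) → 2 ≤ n →
    (α : ℕ ↔ ℕ) (β : Sub n ↔ Sub n) (γ : C n ↔ C n) →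
    IsAutMbar n α β γ ⇔ IsActionOf n α β γ
proposition6p2 (suc (suc k)) (s≤s (s≤s z≤n)) α β γ =
  mk⇔ automorphism⇒action action⇒automorphism
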